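{- Let $L$ be a horizontal line of the unit square grid in the plane, and call the unit squares lying on one fixed side of $L$ and having an edge on $L$ the boundary squares. Suppose a collection of pairwise non-overlapping T-tetrominos, each lying entirely on that side of $L$, covers $7$ consecutive boundary squares. Then the collection contains an arithmetic progression of tiles of length two, i.e. two distinct tiles in the same orientation.
   Context: A T-tetromino is the polyomino consisting of four unit grid squares arranged as a row of three squares together with one square attached to the middle square of that row; tiles are placed with their squares on the unit square grid. Two tiles are in the same orientation if one is a translate of the other. An arithmetic progression (AP) of tiles of length $l$ is a sequence $T_1,\dots,T_l$ of distinct tiles, all in the same orientation, such that the translation vector carrying $T_i$ to $T_{i+1}$ is the same for all $1\le i\le l-1$. -}

module Defs where

open import Data.Integer using (ℤ; +_; _+_; _-_; _≤_; _<_)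
open import Data.Fin using (Fin; zero; suc; toℕ)
open import Data.Product using (_×_; _,_; Σ; ∃)
open import Data.List using (List; []; _∷_; map)
open import Data.List.Membership.Propositional using (_∈_)
open import Relation.Binary.PropositionalEquality using (_≡_)
open import Relation.Nullary using (¬_)
open import Function.Bundles using (_⇔_)

-- A unit square of the grid, named by the integer coordinates (x , y)
-- of its lower-left corner.
Cell : Set
Cell = ℤ × ℤ

_⊕_ : Cell → Cell → Cell
(a , b) ⊕ (c , d) = (a + c , b + d)

_⊖_ : Cell → Cell → Cell
(a , b) ⊖ (c , d) = (a - c , b - d)

-- The four placements (rotations) of the T-tetromino, as offsets of its
-- four squares: a row of three squares plus one square attached to the
-- middle square of the row.  (Reflections give nothing new.)
shape : Fin 4 → List Cell
shape zero                   = (+ 0 , + 0) ∷ (+ 1 , + 0) ∷ (+ 2 , + 0) ∷ (+ 1 , + 1) ∷ []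
shape (suc zero)             = (+ 0 , + 1) ∷ (+ 1 , + 1) ∷ (+ 2 , + 1) ∷ (+ 1 , + 0) ∷ []
shape (suc (suc zero))       = (+ 0 , + 0) ∷ (+ 0 , + 1) ∷ (+ 0 , + 2) ∷ (+ 1 , + 1) ∷ []
shape (suc (suc (suc zero))) = (+ 1 , + 0) ∷ (+ 1 , + 1) ∷ (+ 1 , + 2) ∷ (+ 0 , + 1) ∷ []

record Tile : Set where
  constructor tile
  field
    rot    : Fin 4
    anchor : Cell

_∈T_ : Cell → Tile → Set
c ∈T tile o a = c ∈ map (a ⊕_) (shape o)

SameTile : Tile → Tile → Set
SameTile t u = ∀ c → (c ∈T t) ⇔ (c ∈T u)

Distinct : Tile → Tile → Set
Distinct t u = ¬ SameTile t u

SameOrientation : Tile → Tile → Set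
SameOrientation t u = ∃ λ (v : Cell) → ∀ c → (c ∈T u) ⇔ ((c ⊖ v) ∈T t)

-- The horizontal line L is  y = h ; the fixed side is above or below it.
data Side : Set where
  above below : Side

OnSide : ℤ → Side → Cell → Set
OnSide h above (x , y) = h ≤ y
OnSide h below (x , y) = y < h

boundaryRow : ℤ → Side → ℤ
boundaryRow h above = h
boundaryRow h below = h - + 1

-- A tile lying on one side of L can meet the boundary row only in its own row facing L.
-- Over the four orientations these facing rows have 3 + 1 + 1 + 1 = 6 cells, so among
-- seven boundary squares two are covered by tiles of the same orientation, each at the
-- same cell of its tile.  Those tiles are translates of each other, and they differ
-- because the lower-left corner of a tile's bounding box recovers its translation.
module Submission where

open import Defs
open import Data.Integer using (ℤ; +_; _+_; _-_; -_; _≤_; _≤?_)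
  renaming (_≟_ to _≟ℤ_)
import Data.Integer.Properties as ℤ
open import Data.Integer.Tactic.RingSolver using (solve-∀)
import Data.Nat as ℕ
open import Data.Nat.Properties using (n<1+n)
import Data.Fin as Fin
open import Data.Fin using (Fin; zero; suc; toℕ; #_)
open import Data.Fin.Properties using (pigeonhole; <⇒≢; toℕ-injective)
  renaming (all? to all-Fin?; any? to any-Fin?; _≟_ to _≟F_)
open import Data.Product using (_×_; _,_; ∃; ∃₂; proj₁; proj₂)
open import Data.Product.Properties using (≡-dec)
open import Data.Empty using (⊥)
open import Data.List.Relation.Unary.All as All using (All)
open import Data.List.Relation.Unary.Any as Any using (Any)
open import Data.List.Membership.Propositional using (_∈_; find)
open import Data.List.Membership.Propositional.Properties using (∈-map⁺; ∈-map⁻)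
open import Data.Vec using (Vec; []; _∷_; lookup)
open import Function using (_∘_)
open import Function.Bundles using (mk⇔; Equivalence)
open import Function.Properties.Equivalence using () renaming (sym to ⇔-sym)
open import Relation.Binary.PropositionalEquality
open import Relation.Binary.Definitions using (DecidableEquality)
open import Relation.Nullary using (Dec)
open import Relation.Nullary.Decidable using (from-yes; _×-dec_; _→-dec_)

neg-+-cancel : ∀ i j → - i + (i + j) ≡ j
neg-+-cancel = solve-∀

+-cancelˡ-≡ : ∀ i {j k} → i + j ≡ i + k → j ≡ k
+-cancelˡ-≡ i {j} {k} eq = begin
  j                ≡⟨ neg-+-cancel i j ⟨
  - i + (i + j)    ≡⟨ cong (λ m → - i + m) eq ⟩
  - i + (i + k)    ≡⟨ neg-+-cancel i k ⟩
  k                ∎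
  where open ≡-Reasoning

+-cancelˡ-≤ : ∀ i {j k} → i + j ≤ i + k → j ≤ k
+-cancelˡ-≤ i {j} {k} le =
  subst₂ _≤_ (neg-+-cancel i j) (neg-+-cancel i k) (ℤ.+-monoʳ-≤ (- i) le)

i+j≡i : ∀ i {j} → j ≡ + 0 → i + j ≡ i
i+j≡i i refl = ℤ.+-identityʳ i

≤-+-nonneg : ∀ i {j} → + 0 ≤ j → i ≤ i + j
≤-+-nonneg i {j} 0≤j = subst (_≤ i + j) (ℤ.+-identityʳ i) (ℤ.+-monoʳ-≤ i 0≤j)

∈T-intro : ∀ {r o} a → o ∈ shape r → (a ⊕ o) ∈T tile r a
∈T-intro a = ∈-map⁺ (a ⊕_)

∈T-elim : ∀ {r a c} → c ∈T tile r a → ∃ λ o → o ∈ shape r × c ≡ a ⊕ o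
∈T-elim {a = a} = ∈-map⁻ (a ⊕_)

topRow : Fin 4 → ℤ
topRow zero                   = + 1
topRow (suc zero)             = + 1
topRow (suc (suc zero))       = + 2
topRow (suc (suc (suc zero))) = + 2

InBoundingBox : Fin 4 → Cell → Set
InBoundingBox r (x , y) = + 0 ≤ x × + 0 ≤ y × y ≤ topRow r

shape-in-boundingBox : ∀ r → All (InBoundingBox r) (shape r)
shape-in-boundingBox = from-yes (all-Fin? λ r → All.all? (inBox? r) (shape r))
  where
  inBox? : ∀ r o → Dec (InBoundingBox r o)
  inBox? r (x , y) = (+ 0 ≤? x) ×-dec (+ 0 ≤? y) ×-dec (y ≤? topRow r)

shape-meets-left : ∀ r → Any (λ o → proj₁ o ≡ + 0) (shape r)
shape-meets-left = from-yes (all-Fin? λ r → Any.any? (λ o → proj₁ o ≟ℤ + 0) (shape r))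

shape-meets-bottom : ∀ r → Any (λ o → proj₂ o ≡ + 0) (shape r)
shape-meets-bottom = from-yes (all-Fin? λ r → Any.any? (λ o → proj₂ o ≟ℤ + 0) (shape r))

shape-meets-top : ∀ r → Any (λ o → proj₂ o ≡ topRow r) (shape r)
shape-meets-top = from-yes (all-Fin? λ r → Any.any? (λ o → proj₂ o ≟ℤ topRow r) (shape r))

anchor-lowerLeft : ∀ {r a c} → c ∈T tile r a → proj₁ a ≤ proj₁ c × proj₂ a ≤ proj₂ c
anchor-lowerLeft {r} {a} c∈ with o , o∈ , refl ← ∈T-elim {r} {a} c∈
  with 0≤x , 0≤y , _ ← All.lookup (shape-in-boundingBox r) o∈
  = ≤-+-nonneg (proj₁ a) 0≤x , ≤-+-nonneg (proj₂ a) 0≤y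

sameTile⇒anchor≥ : ∀ {r r' a b} → SameTile (tile r a) (tile r' b) →
                   proj₁ b ≤ proj₁ a × proj₂ b ≤ proj₂ a
sameTile⇒anchor≥ {r} {r'} {a} {b} same = column , row
  where
  moved : ∀ {o} → o ∈ shape r → (a ⊕ o) ∈T tile r' b
  moved o∈ = Equivalence.to (same _) (∈T-intro a o∈)

  column : proj₁ b ≤ proj₁ a
  column with o , o∈ , x≡0 ← find (shape-meets-left r) =
    subst (proj₁ b ≤_) (i+j≡i (proj₁ a) x≡0)
      (proj₁ (anchor-lowerLeft {r'} {b} (moved o∈)))

  row : proj₂ b ≤ proj₂ a
  row with o , o∈ , y≡0 ← find (shape-meets-bottom r) =
    subst (proj₂ b ≤_) (i+j≡i (proj₂ a) y≡0)
      (proj₂ (anchor-lowerLeft {r'} {b} (moved o∈)))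

sameTile⇒sameAnchor : ∀ {r r' a b} → SameTile (tile r a) (tile r' b) → a ≡ b
sameTile⇒sameAnchor {a = a} {b} same =
  cong₂ _,_ (ℤ.≤-antisym (proj₁ a≤b) (proj₁ b≤a)) (ℤ.≤-antisym (proj₂ a≤b) (proj₂ b≤a))
  where
  b≤a : proj₁ b ≤ proj₁ a × proj₂ b ≤ proj₂ a
  b≤a = sameTile⇒anchor≥ same

  a≤b : proj₁ a ≤ proj₁ b × proj₂ a ≤ proj₂ b
  a≤b = sameTile⇒anchor≥ (λ c → ⇔-sym (same c))

⊕-⊖-translate : ∀ a b o → (b ⊕ o) ⊖ (b ⊖ a) ≡ a ⊕ o
⊕-⊖-translate (a₁ , a₂) (b₁ , b₂) (o₁ , o₂) = cong₂ _,_ (identity a₁ b₁ o₁) (identity a₂ b₂ o₂)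
  where
  identity : ∀ a b o → (b + o) - (b - a) ≡ a + o
  identity = solve-∀

⊕-translate : ∀ a b o → (a ⊕ o) ⊕ (b ⊖ a) ≡ b ⊕ o
⊕-translate (a₁ , a₂) (b₁ , b₂) (o₁ , o₂) = cong₂ _,_ (identity a₁ b₁ o₁) (identity a₂ b₂ o₂)
  where
  identity : ∀ a b o → (a + o) + (b - a) ≡ b + o
  identity = solve-∀

⊖-⊕-cancel : ∀ c v → (c ⊖ v) ⊕ v ≡ c
⊖-⊕-cancel (c₁ , c₂) (v₁ , v₂) = cong₂ _,_ (identity c₁ v₁) (identity c₂ v₂)
  where
  identity : ∀ c v → (c - v) + v ≡ c
  identity = solve-∀

translates-sameOrientation : ∀ r a b → SameOrientation (tile r a) (tile r b)
translates-sameOrientation r a b = b ⊖ a , λ c → mk⇔ (to c) (from c)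
  where
  to : ∀ c → c ∈T tile r b → (c ⊖ (b ⊖ a)) ∈T tile r a
  to c c∈ with o , o∈ , refl ← ∈T-elim {r} {b} c∈ =
    subst (_∈T tile r a) (sym (⊕-⊖-translate a b o)) (∈T-intro a o∈)

  from : ∀ c → (c ⊖ (b ⊖ a)) ∈T tile r a → c ∈T tile r b
  from c c∈ with o , o∈ , eq ← ∈T-elim {r} {a} c∈ =
    subst (_∈T tile r b) b⊕o≡c (∈T-intro b o∈)
    where
    open ≡-Reasoning
    b⊕o≡c : b ⊕ o ≡ c
    b⊕o≡c = begin
      b ⊕ o                    ≡⟨ ⊕-translate a b o ⟨
      (a ⊕ o) ⊕ (b ⊖ a)        ≡⟨ cong (_⊕ (b ⊖ a)) eq ⟨
      (c ⊖ (b ⊖ a)) ⊕ (b ⊖ a)  ≡⟨ ⊖-⊕-cancel c (b ⊖ a) ⟩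
      c                        ∎

facingRow : Side → Fin 4 → ℤ
facingRow above r = + 0
facingRow below r = topRow r

boundary-cell-in-facingRow : ∀ {h s r a o} → (∀ c → c ∈T tile r a → OnSide h s c) →
  o ∈ shape r → proj₂ a + proj₂ o ≡ boundaryRow h s → proj₂ o ≡ facingRow s r
boundary-cell-in-facingRow {s = above} {r} {a} {o} onSide o∈ onL
  with f , f∈ , fy≡0 ← find (shape-meets-bottom r) =
  ℤ.≤-antisym (+-cancelˡ-≤ (proj₂ a) ay+oy≤ay+0) 0≤oy
  where
  0≤oy : + 0 ≤ proj₂ o
  0≤oy = proj₁ (proj₂ (All.lookup (shape-in-boundingBox r) o∈))

  ay+oy≤ay+0 : proj₂ a + proj₂ o ≤ proj₂ a + + 0
  ay+oy≤ay+0 =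
    subst₂ _≤_ (sym onL) (cong (λ y → proj₂ a + y) fy≡0) (onSide _ (∈T-intro a f∈))
boundary-cell-in-facingRow {h} {below} {r} {a} {o} onSide o∈ onL
  with f , f∈ , fy≡top ← find (shape-meets-top r) =
  ℤ.≤-antisym oy≤top (+-cancelˡ-≤ (proj₂ a) ay+top≤ay+oy)
  where
  oy≤top : proj₂ o ≤ topRow r
  oy≤top = proj₂ (proj₂ (All.lookup (shape-in-boundingBox r) o∈))

  ay+top≤ay+oy : proj₂ a + topRow r ≤ proj₂ a + proj₂ o
  ay+top≤ay+oy =
    subst₂ _≤_ (cong (λ y → proj₂ a + y) fy≡top) (trans (ℤ.+-comm _ h) (sym onL))
      (ℤ.i<j⇒i≤pred[j] (onSide _ (∈T-intro a f∈)))

Placement : Set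
Placement = Fin 4 × Cell

placements : Side → Vec Placement 6
placements above = (# 0 , (+ 0 , + 0)) ∷ (# 0 , (+ 1 , + 0)) ∷ (# 0 , (+ 2 , + 0))
                 ∷ (# 1 , (+ 1 , + 0)) ∷ (# 2 , (+ 0 , + 0)) ∷ (# 3 , (+ 1 , + 0)) ∷ []
placements below = (# 1 , (+ 0 , + 1)) ∷ (# 1 , (+ 1 , + 1)) ∷ (# 1 , (+ 2 , + 1))
                 ∷ (# 0 , (+ 1 , + 1)) ∷ (# 2 , (+ 0 , + 2)) ∷ (# 3 , (+ 1 , + 2)) ∷ []

FacingCellsArePlacements : Side → Set
FacingCellsArePlacements s =
  ∀ r → All (λ o → proj₂ o ≡ facingRow s r → ∃ λ k → lookup (placements s) k ≡ (r , o)) (shape r)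

facingCellsArePlacements? : ∀ s → Dec (FacingCellsArePlacements s)
facingCellsArePlacements? s = all-Fin? λ r → All.all? (λ o →
  (proj₂ o ≟ℤ facingRow s r) →-dec any-Fin? (λ k → lookup (placements s) k ≟P (r , o))) (shape r)
  where
  _≟P_ : DecidableEquality Placement
  _≟P_ = ≡-dec _≟F_ (≡-dec _≟ℤ_ _≟ℤ_)

facing-cells-are-placements : ∀ s → FacingCellsArePlacements s
facing-cells-are-placements above = from-yes (facingCellsArePlacements? above)
facing-cells-are-placements below = from-yes (facingCellsArePlacements? below)

record Placed (t : Tile) (b : Cell) (p : Placement) : Set where
  constructor placed
  field
    rot≡    : Tile.rot t ≡ proj₁ p
    square≡ : b ≡ Tile.anchor t ⊕ proj₂ p

boundary-square-placed : ∀ {h s t b} → (∀ c → c ∈T t → OnSide h s c) → b ∈T t →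
  proj₂ b ≡ boundaryRow h s → ∃ λ k → Placed t b (lookup (placements s) k)
boundary-square-placed {s = s} {tile r a} onSide b∈ onL
  with o , o∈ , refl ← ∈T-elim {r} {a} b∈
  with k , eq ← All.lookup (facing-cells-are-placements s r) o∈
                  (boundary-cell-in-facingRow {a = a} onSide o∈ onL)
  = k , subst (Placed (tile r a) (a ⊕ o)) (sym eq) (placed refl refl)

placed-apart⇒distinct-translates : ∀ {t u b b' p} → Placed t b p → Placed u b' p → b ≢ b' →
  Distinct t u × SameOrientation t u
placed-apart⇒distinct-translates {tile r a} {tile _ a'} {p = _ , o}
  (placed refl refl) (placed refl refl) apart =
  (λ same → apart (cong (_⊕ o) (sameTile⇒sameAnchor {a = a} {a'} same))) ,
  translates-sameOrientation r a a'

two-placed-alike : ∀ {m n} {t : Fin n → Tile} {b : Fin n → Cell} (ps : Fin m → Placement) →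
  m ℕ.< n → (∀ i → ∃ λ k → Placed (t i) (b i) (ps k)) →
  ∃₂ λ i j → i Fin.< j × ∃ λ p → Placed (t i) (b i) p × Placed (t j) (b j) p
two-placed-alike {t = t} {b} ps m<n placement
  with i , j , i<j , same-k ← pigeonhole m<n (proj₁ ∘ placement) =
  i , j , i<j , _ , proj₂ (placement i) ,
  subst (Placed (t j) (b j) ∘ ps) (sym same-k) (proj₂ (placement j))

theorem1 : (h : ℤ) (s : Side) (C : Tile → Set) →
    (∀ t → C t → ∀ c → c ∈T t → OnSide h s c) →
    (∀ t u → C t → C u → Distinct t u → ∀ c → c ∈T t → c ∈T u → ⊥) →
    (x₀ : ℤ) →
    (∀ (i : Fin 7) → ∃ λ t → C t × ((x₀ + + toℕ i , boundaryRow h s) ∈T t)) →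
    ∃ λ t → ∃ λ u → C t × C u × Distinct t u × SameOrientation t u
theorem1 h s C onSide _ x₀ cover =
  let i , j , i<j , _ , placedᵢ , placedⱼ =
        two-placed-alike (lookup (placements s)) (n<1+n 6) placement
  in tile-of i , tile-of j , in-C i , in-C j ,
     placed-apart⇒distinct-translates placedᵢ placedⱼ (squares-apart (<⇒≢ i<j))
  where
  square : Fin 7 → Cell
  square i = (x₀ + + toℕ i , boundaryRow h s)

  tile-of : Fin 7 → Tile
  tile-of i = proj₁ (cover i)

  in-C : ∀ i → C (tile-of i)
  in-C i = proj₁ (proj₂ (cover i))

  placement : ∀ i → ∃ λ k → Placed (tile-of i) (square i) (lookup (placements s) k)
  placement i =
    boundary-square-placed {t = tile-of i} (onSide (tile-of i) (in-C i)) (proj₂ (proj₂ (cover i))) refl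

  squares-apart : ∀ {i j} → i ≢ j → square i ≢ square j
  squares-apart i≢j eq = i≢j (toℕ-injective (ℤ.+-injective (+-cancelˡ-≡ x₀ (cong proj₁ eq))))
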